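{- Let $b\ge1$ be an integer and $G$ a $(b+1)$-degenerate graph. Consider the $(1:b)$ component game on $G$ in which Maker moves first and Breaker plays according to strategy $\mathcal{S}_B$. Then, whatever Maker does, at the beginning of every round every H-comp $C$ satisfies exactly one of the following: (i) Maker has claimed exactly one edge above $C$ and $F(C)=\emptyset$; (ii) Maker has claimed no edge above $C$ and $|F(C)|\le\max\{0,\,b+2-|V(C)|\}$.
   Context: A graph is $(b+1)$-degenerate if it has no nonempty subgraph of minimum degree at least $b+2$. The $(b+2)$-peeling process: $G_0=G$, and $G_{t+1}$ is obtained from $G_t$ by deleting all edges incident with vertices of degree at most $b+1$ in $G_t$ (vertices are kept). The rank of a vertex is $\rho(v)=\min\{t\ge0:\deg_{G_t}(v)<b+2\}$ (finite since $G$ is $(b+1)$-degenerate). In the $(1:b)$ component game on $G$, each round consists of a move of Maker, who claims one unclaimed ("free") edge of $G$, followed by a move of Breaker, who claims $b$ free edges, one at a time (each single claim is a step). An edge $uv$ of $G$ is horizontal if $\rho(u)=\rho(v)$ and vertical otherwise. An H-comp is a connected component (possibly a single vertex) of the graph on $V(G)$ whose edges are the horizontal edges claimed by Maker; all its vertices share a rank, called the rank $\rho(C)$ of the H-comp $C$. A vertical edge $e$ is above $C$ if the endpoint of $e$ of smaller rank lies in $V(C)$. $F(C)$ is the set of free edges of $G_{\rho(C)}$ incident with $V(C)$; $F_V(C)$ and $F_H(C)$ are its vertical and horizontal edges. Strategy $\mathcal{S}_B$: when Maker claims an edge $e=uv$ with $\rho(u)\le\rho(v)$, let $C$ be the H-comp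 containing $u$ after her move; in each of his $b$ steps of that round Breaker claims an arbitrary edge of $F_V(C)$ if $F_V(C)\neq\emptyset$, otherwise an arbitrary edge of $F_H(C)$ if $F_H(C)\ne\emptyset$, otherwise an arbitrary free edge. -}

module Defs where

open import Data.Nat using (ℕ; zero; suc; _+_; _∸_; _≤_; _<_; _≤ᵇ_; _<ᵇ_; _≡ᵇ_)
open import Data.Bool using (Bool; true; false; _∧_; _∨_; not; if_then_else_)
open import Data.Fin using (Fin; _≟_)
open import Data.Product using (Σ; ∃; _×_; _,_; proj₁; proj₂)
open import Data.Sum using (_⊎_)
open import Relation.Nullary using (¬_)
open import Relation.Nullary.Decidable using (⌊_⌋)
open import Relation.Binary.PropositionalEquality using (_≡_; _≢_)

count : ∀ {k} → (Fin k → Bool) → ℕ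
count {zero}  p = 0
count {suc k} p = (if p Fin.zero then 1 else 0) + count (λ i → p (Fin.suc i))

_=ᶠ_ : ∀ {k} → Fin k → Fin k → Bool
x =ᶠ y = ⌊ x ≟ y ⌋

record Graph (n m : ℕ) : Set where
  field
    ends   : Fin m → Fin n × Fin n
    noLoop : ∀ e → proj₁ (ends e) ≢ proj₂ (ends e)
    simple : ∀ e f →
      ((proj₁ (ends e) ≡ proj₁ (ends f)) × (proj₂ (ends e) ≡ proj₂ (ends f)))
      ⊎ ((proj₁ (ends e) ≡ proj₂ (ends f)) × (proj₂ (ends e) ≡ proj₁ (ends f)))
      → e ≡ f

module GraphDefs {n m : ℕ} (G : Graph n m) where
  open Graph G

  src tgt : Fin m → Fin n
  src e = proj₁ (ends e)
  tgt e = proj₂ (ends e)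

  incident : Fin m → Fin n → Bool
  incident e v = (src e =ᶠ v) ∨ (tgt e =ᶠ v)

  deg : (Fin m → Bool) → Fin n → ℕ
  deg S v = count (λ e → S e ∧ incident e v)

  -- (b+1)-degenerate: no nonempty subgraph (W , S) with minimum degree ≥ b+2
  Degenerate : ℕ → Set
  Degenerate b = (W : Fin n → Bool) (S : Fin m → Bool) →
    (∀ e → S e ≡ true → (W (src e) ≡ true) × (W (tgt e) ≡ true)) →
    (∃ λ v → W v ≡ true) →
    ¬ (∀ v → W v ≡ true → suc (suc b) ≤ deg S v)

  -- The (b+2)-peeling process: alive b t e ⇔ e is an edge of G_t.
  alive : ℕ → ℕ → Fin m → Bool
  alive b zero    e = true
  alive b (suc t) e = alive b t e
                    ∧ (suc (suc b) ≤ᵇ deg (alive b t) (src e))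
                    ∧ (suc (suc b) ≤ᵇ deg (alive b t) (tgt e))

  IsRank : ℕ → Fin n → ℕ → Set
  IsRank b v t = (deg (alive b t) v < suc (suc b))
               × (∀ s → s < t → suc (suc b) ≤ deg (alive b s) v)

data Owner : Set where
  free maker breaker : Owner

isFree isMaker : Owner → Bool
isFree free = true
isFree _    = false
isMaker maker = true
isMaker _     = false

module Game {n m : ℕ} (G : Graph n m) (b : ℕ) (ρ : Fin n → ℕ) where
  open GraphDefs G public

  State : Set
  State = Fin m → Owner

  start : State
  start _ = free

  set : State → Fin m → Owner → State
  set s e o f = if f =ᶠ e then o else s f

  Free : State → Fin m → Set
  Free s e = isFree (s e) ≡ true

  horizontal : Fin m → Bool
  horizontal e = ρ (src e) ≡ᵇ ρ (tgt e)

  -- endpoint of e of smaller rank (the first one in case of a tie)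
  low : Fin m → Fin n
  low e = if ρ (tgt e) <ᵇ ρ (src e) then tgt e else src e

  high : Fin m → Fin n
  high e = if ρ (tgt e) <ᵇ ρ (src e) then src e else tgt e

  mh : State → Fin m → Bool
  mh s e = isMaker (s e) ∧ horizontal e

  reach : State → ℕ → Fin n → Fin n → Bool
  reach s zero    u w = u =ᶠ w
  reach s (suc k) u w = reach s k u w ∨
    (0 <ᵇ count (λ e → mh s e ∧
        ((reach s k u (src e) ∧ (tgt e =ᶠ w)) ∨ (reach s k u (tgt e) ∧ (src e =ᶠ w)))))

  -- w ∈ V(C) where C is the H-comp containing r (paths of length ≤ n suffice)
  inC : State → Fin n → Fin n → Bool
  inC s r w = reach s n r w

  sizeC : State → Fin n → ℕ
  sizeC s r = count (inC s r)

  rankC : Fin n → ℕ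
  rankC r = ρ r

  inF : State → Fin n → Fin m → Bool
  inF s r e = isFree (s e) ∧ alive b (rankC r) e ∧ (inC s r (src e) ∨ inC s r (tgt e))

  inFV inFH : State → Fin n → Fin m → Bool
  inFV s r e = inF s r e ∧ not (horizontal e)
  inFH s r e = inF s r e ∧ horizontal e

  makerAbove : State → Fin n → ℕ
  makerAbove s r = count (λ e → isMaker (s e) ∧ not (horizontal e) ∧ inC s r (low e))

  Allowed : State → Fin n → Fin m → Set
  Allowed s u e = Free s e ×
    ( (inFV s u e ≡ true)
    ⊎ ((¬ ∃ λ f → inFV s u f ≡ true) × (inFH s u e ≡ true))
    ⊎ ((¬ ∃ λ f → inFV s u f ≡ true) × (¬ ∃ λ f → inFH s u f ≡ true)) )

  -- k Breaker steps following S_B w.r.t. the H-comp of u; if no free edge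
  -- remains, Breaker cannot claim (the game is over).
  data BSteps (u : Fin n) : ℕ → State → State → Set where
    done  : ∀ {s} → BSteps u zero s s
    claim : ∀ {k s s'} (e : Fin m) → Allowed s u e →
            BSteps u k (set s e breaker) s' → BSteps u (suc k) s s'
    stuck : ∀ {k s} → (∀ e → ¬ Free s e) → BSteps u (suc k) s s

  Round : State → State → Set
  Round s s' = ∃ λ e → Free s e × BSteps (low e) b (set s e maker) s'

  data Reachable : State → Set where
    init : Reachable start
    step : ∀ {s s'} → Reachable s → Round s s' → Reachable s'

  CaseI : State → Fin n → Set
  CaseI s r = (makerAbove s r ≡ 1) × (∀ e → inF s r e ≡ false)

  CaseII : State → Fin n → Set
  CaseII s r = (makerAbove s r ≡ 0) × (count (inF s r) ≤ (suc (suc b) ∸ sizeC s r))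

module Submission where

-- The two alternatives form an invariant of the game.  Initially each H-comp is a single
-- vertex v, and F(v) lies among the fewer than b+2 edges of G_ρ(v) at v.  Suppose Maker
-- claims e, and let C be the H-comp of its lower endpoint.  Since e ∈ F(C), C was in case
-- (ii).  If e is vertical, C now has one Maker edge above it and at most b free edges left
-- in F(C), all of which Breaker takes.  If e is horizontal it either lies inside C, or joins
-- C to the H-comp C' of its other endpoint; C' was in case (ii) as well, and as e was
-- counted in both F(C) and F(C'), |F(C ∪ C')| ≤ |F(C)| + |F(C')| − 2 ≤ 2b + 2 − |C| − |C'|,
-- which Breaker's b claims bring down to b + 2 − |C ∪ C'|.  Every other H-comp is unchanged
-- apart from losing free edges.

open import Defs
open import Data.Nat using (ℕ; zero; suc; _+_; _∸_; _≤_; _<_; _<ᵇ_; _≡ᵇ_; z≤n; s≤s)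
open import Data.Nat.Properties hiding (_≟_; suc-injective)
open import Data.Bool using (Bool; true; false; _∧_; _∨_; not; T; if_then_else_)
open import Data.Bool.Properties using (∧-zeroʳ; ∧-identityʳ; ¬-not)
import Data.Bool.Properties as Bool
open import Data.Fin using (Fin; _≟_)
open import Data.Fin.Properties using (all?; ¬∀⟶∃¬; suc-injective)
open import Data.Product using (∃; _×_; _,_; proj₁; proj₂)
open import Data.Sum using (_⊎_; inj₁; inj₂)
open import Data.Unit using (tt)
open import Relation.Nullary using (¬_; yes; no; contradiction)
open import Relation.Nullary.Decidable using (isYes≗does; dec-true; dec-false; toWitness)
open import Relation.Binary.PropositionalEquality hiding ([_])
open import Function using (_∘_)
open import Algebra.Properties.CommutativeSemigroup +-commutativeSemigroup using (interchange)

T⇒true : ∀ {a} → T a → a ≡ true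
T⇒true {true} _ = refl

true⇒T : ∀ {a} → a ≡ true → T a
true⇒T refl = tt

∧-trueˡ : ∀ {a c} → a ∧ c ≡ true → a ≡ true
∧-trueˡ {true} _ = refl

∧-trueʳ : ∀ {a c} → a ∧ c ≡ true → c ≡ true
∧-trueʳ {true} p = p

∧-true : ∀ {a c} → a ≡ true → c ≡ true → a ∧ c ≡ true
∧-true refl refl = refl

∨-trueˡ : ∀ {a c} → a ≡ true → a ∨ c ≡ true
∨-trueˡ refl = refl

∨-trueʳ : ∀ {a c} → c ≡ true → a ∨ c ≡ true
∨-trueʳ {true} _ = refl
∨-trueʳ {false} p = p

∨-true⁻ : ∀ {a c} → a ∨ c ≡ true → a ≡ true ⊎ c ≡ true
∨-true⁻ {true} _ = inj₁ refl
∨-true⁻ {false} p = inj₂ p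

∧-falseˡ : ∀ {a c} → a ≡ false → a ∧ c ≡ false
∧-falseˡ refl = refl

false⇒¬true : ∀ {a} → a ≡ false → ¬ a ≡ true
false⇒¬true refl ()

true-⇔⇒≡ : ∀ {a c} → (a ≡ true → c ≡ true) → (c ≡ true → a ≡ true) → a ≡ c
true-⇔⇒≡ {true} {true} _ _ = refl
true-⇔⇒≡ {true} {false} f _ = sym (f refl)
true-⇔⇒≡ {false} {true} _ g = g refl
true-⇔⇒≡ {false} {false} _ _ = refl

_⊆ᵇ_ : ∀ {A : Set} → (A → Bool) → (A → Bool) → Set
p ⊆ᵇ q = ∀ x → p x ≡ true → q x ≡ true

=ᶠ-refl : ∀ {k} (x : Fin k) → (x =ᶠ x) ≡ true
=ᶠ-refl x = trans (isYes≗does (x ≟ x)) (dec-true (x ≟ x) refl)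

=ᶠ⇒≡ : ∀ {k} {x y : Fin k} → (x =ᶠ y) ≡ true → x ≡ y
=ᶠ⇒≡ {x = x} {y} h = toWitness {a? = x ≟ y} (true⇒T h)

≢⇒=ᶠfalse : ∀ {k} {x y : Fin k} → x ≢ y → (x =ᶠ y) ≡ false
≢⇒=ᶠfalse {x = x} {y} x≢y = trans (isYes≗does (x ≟ y)) (dec-false (x ≟ y) x≢y)

isFree⇒free : ∀ {o} → isFree o ≡ true → o ≡ free
isFree⇒free {free} _ = refl

-- Counting

suc-=ᶠ : ∀ {k} (x y : Fin k) → (Fin.suc x =ᶠ Fin.suc y) ≡ (x =ᶠ y)
suc-=ᶠ x y = true-⇔⇒≡ (λ h → subst (λ z → (x =ᶠ z) ≡ true) (suc-injective (=ᶠ⇒≡ h)) (=ᶠ-refl x))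
                       (λ h → subst (λ z → (Fin.suc x =ᶠ Fin.suc z) ≡ true) (=ᶠ⇒≡ h) (=ᶠ-refl _))

_without_ : ∀ {k} → (Fin k → Bool) → Fin k → Fin k → Bool
(p without i) j = p j ∧ not (j =ᶠ i)

without-suc : ∀ {k} (p : Fin (suc k) → Bool) i → (p without Fin.suc i) ∘ Fin.suc ≗ (p ∘ Fin.suc) without i
without-suc p i j = cong (λ c → p (Fin.suc j) ∧ not c) (suc-=ᶠ j i)

count-cong : ∀ {k} {p q : Fin k → Bool} → p ≗ q → count p ≡ count q
count-cong {zero} _ = refl
count-cong {suc k} p≗q =
  cong₂ _+_ (cong (λ c → if c then 1 else 0) (p≗q Fin.zero)) (count-cong (p≗q ∘ Fin.suc))

count-mono : ∀ {k} {p q : Fin k → Bool} → p ⊆ᵇ q → count p ≤ count q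
count-mono {zero} _ = z≤n
count-mono {suc k} {p} {q} p⊆q with p Fin.zero in p0 | q Fin.zero in q0
... | true  | true  = s≤s (count-mono (p⊆q ∘ Fin.suc))
... | true  | false = contradiction (p⊆q Fin.zero p0) (false⇒¬true q0)
... | false | true  = m≤n⇒m≤1+n (count-mono (p⊆q ∘ Fin.suc))
... | false | false = count-mono (p⊆q ∘ Fin.suc)

count≤size : ∀ {k} (p : Fin k → Bool) → count p ≤ k
count≤size {zero} p = z≤n
count≤size {suc k} p with p Fin.zero
... | true  = s≤s (count≤size _)
... | false = m≤n⇒m≤1+n (count≤size _)

count-none : ∀ {k} {p : Fin k → Bool} → (∀ i → p i ≡ false) → count p ≡ 0
count-none {zero} _ = refl
count-none {suc k} {p} none rewrite none Fin.zero = count-none (none ∘ Fin.suc)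

count≡0⇒none : ∀ {k} {p : Fin k → Bool} → count p ≡ 0 → ∀ i → p i ≡ false
count≡0⇒none {suc k} {p} c i with p Fin.zero in p0
count≡0⇒none {suc k} {p} () i | true
count≡0⇒none {suc k} {p} c Fin.zero | false = p0
count≡0⇒none {suc k} {p} c (Fin.suc i) | false = count≡0⇒none c i

witness⇒count≥1 : ∀ {k} {p : Fin k → Bool} {i} → p i ≡ true → 1 ≤ count p
witness⇒count≥1 {suc k} {p} {Fin.zero} pi rewrite pi = s≤s z≤n
witness⇒count≥1 {suc k} {p} {Fin.suc i} pi =
  ≤-trans (witness⇒count≥1 {p = p ∘ Fin.suc} pi) (m≤n+m _ _)

count≥1⇒witness : ∀ {k} {p : Fin k → Bool} → 1 ≤ count p → ∃ λ i → p i ≡ true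
count≥1⇒witness {suc k} {p} c with p Fin.zero in p0
... | true = Fin.zero , p0
... | false with count≥1⇒witness {p = p ∘ Fin.suc} c
... | i , pi = Fin.suc i , pi

count-remove : ∀ {k} {p : Fin k → Bool} {i} → p i ≡ true → suc (count (p without i)) ≡ count p
count-remove {suc k} {p} {Fin.zero} pi rewrite pi =
  cong suc (count-cong λ j →
    trans (cong (λ c → p (Fin.suc j) ∧ not c) (≢⇒=ᶠfalse {x = Fin.suc j} {Fin.zero} λ ())) (∧-identityʳ _))
count-remove {suc k} {p} {Fin.suc i} pi with p Fin.zero
... | true  = cong suc (trans (cong suc (count-cong (without-suc p i))) (count-remove {p = p ∘ Fin.suc} pi))
... | false = trans (cong suc (count-cong (without-suc p i))) (count-remove {p = p ∘ Fin.suc} pi)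

count-strict : ∀ {k} {p q : Fin k → Bool} {i} → p ⊆ᵇ q → p i ≡ false → q i ≡ true →
  suc (count p) ≤ count q
count-strict {p = p} {q} {i} p⊆q pi qi =
  subst (suc (count p) ≤_) (count-remove {p = q} qi) (s≤s (count-mono p⊆q-i))
  where
  p⊆q-i : p ⊆ᵇ (q without i)
  p⊆q-i j pj = ∧-true (p⊆q j pj) (cong not (≢⇒=ᶠfalse λ { refl → false⇒¬true pi pj }))

count-∨+count-∧ : ∀ {k} (p q : Fin k → Bool) →
  count (λ x → p x ∨ q x) + count (λ x → p x ∧ q x) ≡ count p + count q
count-∨+count-∧ {zero} p q = refl
count-∨+count-∧ {suc k} p q with p Fin.zero | q Fin.zero | count-∨+count-∧ (p ∘ Fin.suc) (q ∘ Fin.suc)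
... | true  | true  | ih = cong suc (trans (+-suc _ _) (trans (cong suc ih) (sym (+-suc _ _))))
... | true  | false | ih = cong suc ih
... | false | true  | ih = trans (cong suc ih) (sym (+-suc _ _))
... | false | false | ih = ih

count-∨≤+ : ∀ {k} (p q : Fin k → Bool) → count (λ x → p x ∨ q x) ≤ count p + count q
count-∨≤+ p q = subst (count (λ x → p x ∨ q x) ≤_) (count-∨+count-∧ p q) (m≤m+n _ _)

count-cong-except : ∀ {k} {p q : Fin k → Bool} {i} → (∀ j → j ≢ i → p j ≡ q j) → p i ≡ q i →
  count p ≡ count q
count-cong-except {p = p} {q} {i} off at = count-cong agree
  where
  agree : p ≗ q
  agree j with j ≟ i
  ... | yes refl = at
  ... | no j≢i = off j j≢i

count-insert : ∀ {k} {p q : Fin k → Bool} {i} → (∀ j → j ≢ i → p j ≡ q j) → p i ≡ true → q i ≡ false →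
  count p ≡ suc (count q)
count-insert {p = p} {q} {i} off pi qi =
  trans (sym (count-remove {p = p} pi)) (cong suc (count-cong-except off' at))
  where
  off' : ∀ j → j ≢ i → (p without i) j ≡ q j
  off' j j≢i = trans (cong (λ c → p j ∧ not c) (≢⇒=ᶠfalse j≢i)) (trans (∧-identityʳ _) (off j j≢i))
  at : (p without i) i ≡ q i
  at = trans (cong (λ c → p i ∧ not c) (=ᶠ-refl i)) (trans (∧-zeroʳ _) (sym qi))

count-singleton : ∀ {k} (i : Fin k) → count (_=ᶠ i) ≡ 1
count-singleton {k} i =
  trans (count-insert {p = _=ᶠ i} {q = λ _ → false} (λ _ → ≢⇒=ᶠfalse) (=ᶠ-refl i) refl)
        (cong suc (count-none {k} {λ _ → false} (λ _ → refl)))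

module Saturation {k : ℕ} (X : ℕ → Fin k → Bool)
  (inflationary : ∀ i → X i ⊆ᵇ X (suc i))
  (determined : ∀ i j → X i ≗ X j → X (suc i) ≗ X (suc j))
  (inhabited : ∃ λ v → X 0 v ≡ true) where

  Stable : ℕ → Set
  Stable i = X (suc i) ≗ X i

  stable-+ : ∀ {i} → Stable i → ∀ d → Stable (d + i)
  stable-+ st zero = st
  stable-+ {i} st (suc d) = determined (suc (d + i)) (d + i) (stable-+ st d)

  stable-or-grows : ∀ i → (∃ λ j → j ≤ i × Stable j) ⊎ suc i ≤ count (X i)
  stable-or-grows zero = inj₂ (witness⇒count≥1 {p = X 0} (proj₂ inhabited))
  stable-or-grows (suc i) with stable-or-grows i
  ... | inj₁ (j , j≤i , st) = inj₁ (j , m≤n⇒m≤1+n j≤i , st)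
  ... | inj₂ grown with all? (λ w → X (suc i) w Bool.≟ X i w)
  ...   | yes st = inj₁ (i , n≤1+n i , st)
  ...   | no ¬st with ¬∀⟶∃¬ k _ (λ w → X (suc i) w Bool.≟ X i w) ¬st
  ...     | w , changed = inj₂ (≤-trans (s≤s grown) (count-strict (inflationary i) old new))
    where
    old : X i w ≡ false
    old = ¬-not λ h → changed (trans (inflationary i w h) (sym h))
    new : X (suc i) w ≡ true
    new = trans (¬-not changed) (cong not old)

  saturated : Stable k
  saturated with stable-or-grows k
  ... | inj₁ (j , j≤k , st) = subst Stable (m∸n+n≡m j≤k) (stable-+ st (k ∸ j))
  ... | inj₂ grown = contradiction (count≤size (X k)) (<⇒≱ grown)

∸-bound⇒+-bound : ∀ {a s k} → 1 ≤ a → a ≤ k ∸ s → a + s ≤ k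
∸-bound⇒+-bound {a} 1≤a a≤k∸s =
  m≤o∸n⇒m+n≤o a (<⇒≤ (m∸n≢0⇒n<m (m<n⇒n≢0 (≤-trans 1≤a a≤k∸s)))) a≤k∸s

+-bound⇒∸-bound : ∀ x s k c → x + s ≤ k + c → x ∸ c ≤ k ∸ s
+-bound⇒∸-bound x s k c x+s≤k+c = begin
  x ∸ c                 ≤⟨ ∸-monoˡ-≤ c (m+n≤o⇒m≤o∸n x x+s≤k+c) ⟩
  (k + c) ∸ s ∸ c       ≡⟨ ∸-+-assoc (k + c) s c ⟩
  (k + c) ∸ (s + c)     ≡⟨ cong₂ _∸_ (+-comm k c) (+-comm s c) ⟩
  (c + k) ∸ (c + s)     ≡⟨ [m+n]∸[m+o]≡n∸o c k s ⟩
  k ∸ s                 ∎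
  where open ≤-Reasoning

merged-bound : ∀ b {x a a' s s'} → 1 ≤ a → a ≤ suc (suc b) ∸ s → 1 ≤ a' → a' ≤ suc (suc b) ∸ s' →
  suc (suc x) ≤ a + a' → x ∸ b ≤ suc (suc b) ∸ (s + s')
merged-bound b {x} {a} {a'} {s} {s'} 1≤a a≤ 1≤a' a'≤ x+2≤ = +-bound⇒∸-bound x (s + s') (suc (suc b)) b
  (≤-pred (≤-pred (begin
    suc (suc x) + (s + s')    ≤⟨ +-monoˡ-≤ (s + s') x+2≤ ⟩
    (a + a') + (s + s')       ≡⟨ interchange a a' s s' ⟩
    (a + s) + (a' + s')       ≤⟨ +-mono-≤ (∸-bound⇒+-bound 1≤a a≤) (∸-bound⇒+-bound 1≤a' a'≤) ⟩
    suc (suc b) + suc (suc b) ≡⟨ trans (+-suc (suc (suc b)) (suc b)) (cong suc (+-suc (suc (suc b)) b)) ⟩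
    suc (suc (suc (suc b) + b)) ∎)))
  where open ≤-Reasoning

module Analysis {n m : ℕ} (G : Graph n m) (b : ℕ) (ρ : Fin n → ℕ)
                (ρ-rank : ∀ v → GraphDefs.IsRank G b v (ρ v)) where
  open Game G b ρ

  -- H-components

  Closed : State → (Fin n → Bool) → Set
  Closed s P = ∀ e → mh s e ≡ true → P (src e) ≡ P (tgt e)

  reach-refl : ∀ s k u → reach s k u u ≡ true
  reach-refl s zero u = =ᶠ-refl u
  reach-refl s (suc k) u = ∨-trueˡ (reach-refl s k u)

  reach-least : ∀ {s P u} → Closed s P → P u ≡ true → ∀ k → reach s k u ⊆ᵇ P
  reach-least {P = P} closed Pu zero w u=w = subst (λ z → P z ≡ true) (=ᶠ⇒≡ u=w) Pu
  reach-least {P = P} closed Pu (suc k) w h with ∨-true⁻ h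
  ... | inj₁ old = reach-least closed Pu k w old
  ... | inj₂ new with count≥1⇒witness (<ᵇ⇒< 0 _ (true⇒T new))
  ...   | e , me∧step with ∨-true⁻ (∧-trueʳ me∧step)
  ...     | inj₁ fwd = subst (λ z → P z ≡ true) (=ᶠ⇒≡ (∧-trueʳ fwd))
                 (trans (sym (closed e (∧-trueˡ me∧step))) (reach-least closed Pu k (src e) (∧-trueˡ fwd)))
  ...     | inj₂ bwd = subst (λ z → P z ≡ true) (=ᶠ⇒≡ (∧-trueʳ bwd))
                 (trans (closed e (∧-trueˡ me∧step)) (reach-least closed Pu k (tgt e) (∧-trueˡ bwd)))

  reach-src→tgt : ∀ s k u e → mh s e ≡ true → reach s k u (src e) ≡ true → reach s (suc k) u (tgt e) ≡ true
  reach-src→tgt s k u e me h =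
    ∨-trueʳ (T⇒true (<⇒<ᵇ (witness⇒count≥1 {i = e} (∧-true me (∨-trueˡ (∧-true h (=ᶠ-refl _)))))))

  reach-tgt→src : ∀ s k u e → mh s e ≡ true → reach s k u (tgt e) ≡ true → reach s (suc k) u (src e) ≡ true
  reach-tgt→src s k u e me h =
    ∨-trueʳ (T⇒true (<⇒<ᵇ (witness⇒count≥1 {i = e} (∧-true me (∨-trueʳ (∧-true h (=ᶠ-refl _)))))))

  -- inC only follows paths of length ≤ n; saturation makes it closed under one more step.
  reach-saturated : ∀ s u → reach s (suc n) u ≗ inC s u
  reach-saturated s u = Saturation.saturated (λ k → reach s k u) (λ _ _ → ∨-trueˡ) determined
                          (u , reach-refl s zero u)
    where
    determined : ∀ i j → reach s i u ≗ reach s j u → reach s (suc i) u ≗ reach s (suc j) u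
    determined i j same w = cong₂ _∨_ (same w) (cong (0 <ᵇ_) (count-cong λ e → cong (mh s e ∧_)
      (cong₂ _∨_ (cong (_∧ (tgt e =ᶠ w)) (same (src e))) (cong (_∧ (src e =ᶠ w)) (same (tgt e))))))

  inC-refl : ∀ s u → inC s u u ≡ true
  inC-refl s u = reach-refl s n u

  inC-closed : ∀ s u → Closed s (inC s u)
  inC-closed s u e me = true-⇔⇒≡
    (λ h → trans (sym (reach-saturated s u (tgt e))) (reach-src→tgt s n u e me h))
    (λ h → trans (sym (reach-saturated s u (src e))) (reach-tgt→src s n u e me h))

  inC-least : ∀ {s P u} → Closed s P → P u ≡ true → inC s u ⊆ᵇ P
  inC-least closed Pu = reach-least closed Pu n

  inC-trans : ∀ s {r u} → inC s r u ≡ true → inC s u ⊆ᵇ inC s r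
  inC-trans s {r} = inC-least (inC-closed s r)

  inC-sym : ∀ s {r u} → inC s r u ≡ true → inC s u r ≡ true
  inC-sym s {r} = inC-least closed (inC-refl s r) _
    where
    closed : Closed s (λ w → inC s w r)
    closed e me = true-⇔⇒≡ (inC-trans s src∈tgt r) (inC-trans s tgt∈src r)
      where
      tgt∈src : inC s (src e) (tgt e) ≡ true
      tgt∈src = trans (sym (inC-closed s (src e) e me)) (inC-refl s (src e))
      src∈tgt : inC s (tgt e) (src e) ≡ true
      src∈tgt = trans (inC-closed s (tgt e) e me) (inC-refl s (tgt e))

  inC-same : ∀ s {r u} → inC s r u ≡ true → inC s r ≗ inC s u
  inC-same s r∼u x = true-⇔⇒≡ (inC-trans s (inC-sym s r∼u) x) (inC-trans s r∼u x)

  horizontal⇒ρ≡ : ∀ {e} → horizontal e ≡ true → ρ (src e) ≡ ρ (tgt e)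
  horizontal⇒ρ≡ {e} h = ≡ᵇ⇒≡ (ρ (src e)) (ρ (tgt e)) (true⇒T h)

  inC-ρ : ∀ s {r x} → inC s r x ≡ true → ρ x ≡ ρ r
  inC-ρ s {r} {x} h = ≡ᵇ⇒≡ (ρ x) (ρ r) (true⇒T (inC-least closed (T⇒true (≡⇒≡ᵇ (ρ r) (ρ r) refl)) x h))
    where
    closed : Closed s (λ w → ρ w ≡ᵇ ρ r)
    closed e me = cong (_≡ᵇ ρ r) (horizontal⇒ρ≡ (∧-trueʳ me))

  inC-mono : ∀ {s s'} → mh s ⊆ᵇ mh s' → ∀ r → inC s r ⊆ᵇ inC s' r
  inC-mono {s' = s'} mh⊆ r = inC-least (λ e me → inC-closed s' r e (mh⊆ e me)) (inC-refl s' r)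

  inC-cong : ∀ {s s'} → mh s ≗ mh s' → ∀ r → inC s r ≗ inC s' r
  inC-cong same r x =
    true-⇔⇒≡ (inC-mono (λ f → trans (sym (same f))) r x) (inC-mono (λ f → trans (same f)) r x)

  low-cases : ∀ e → (low e ≡ tgt e × ρ (tgt e) < ρ (src e)) ⊎ (low e ≡ src e × ρ (src e) ≤ ρ (tgt e))
  low-cases e with ρ (tgt e) <ᵇ ρ (src e) in lt
  ... | true  = inj₁ (refl , <ᵇ⇒< _ _ (true⇒T lt))
  ... | false = inj₂ (refl , ≮⇒≥ λ tgt<src → false⇒¬true lt (T⇒true (<⇒<ᵇ tgt<src)))

  low-endpoint : ∀ e → low e ≡ src e ⊎ low e ≡ tgt e
  low-endpoint e with low-cases e
  ... | inj₁ (low≡tgt , _) = inj₂ low≡tgt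
  ... | inj₂ (low≡src , _) = inj₁ low≡src

  low-minimal : ∀ e → ρ (low e) ≤ ρ (src e) × ρ (low e) ≤ ρ (tgt e)
  low-minimal e with low-cases e
  ... | inj₁ (low≡tgt , tgt<src) rewrite low≡tgt = <⇒≤ tgt<src , ≤-refl
  ... | inj₂ (low≡src , src≤tgt) rewrite low≡src = ≤-refl , src≤tgt

  horizontal⇒low≡src : ∀ {e} → horizontal e ≡ true → low e ≡ src e
  horizontal⇒low≡src {e} h with low-cases e
  ... | inj₁ (_ , tgt<src) = contradiction (sym (horizontal⇒ρ≡ h)) (<⇒≢ tgt<src)
  ... | inj₂ (low≡src , _) = low≡src

  alive-below-ranks : ∀ t e → t ≤ ρ (src e) → t ≤ ρ (tgt e) → alive b t e ≡ true
  alive-below-ranks zero e _ _ = refl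
  alive-below-ranks (suc t) e t<src t<tgt =
    ∧-true (alive-below-ranks t e (<⇒≤ t<src) (<⇒≤ t<tgt))
           (∧-true (T⇒true (≤⇒≤ᵇ (proj₂ (ρ-rank (src e)) t t<src)))
                   (T⇒true (≤⇒≤ᵇ (proj₂ (ρ-rank (tgt e)) t t<tgt))))

  free⇒inF : ∀ s {e w} → Free s e → (w ≡ src e ⊎ w ≡ tgt e) → ρ w ≤ ρ (src e) → ρ w ≤ ρ (tgt e) →
    inF s w e ≡ true
  free⇒inF s {e} {w} e-free endpoint ≤src ≤tgt =
    ∧-true e-free (∧-true (alive-below-ranks (ρ w) e ≤src ≤tgt) (meets endpoint))
    where
    meets : w ≡ src e ⊎ w ≡ tgt e → (inC s w (src e) ∨ inC s w (tgt e)) ≡ true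
    meets (inj₁ refl) = ∨-trueˡ (inC-refl s w)
    meets (inj₂ refl) = ∨-trueʳ (inC-refl s w)

  free⇒inF-low : ∀ s {e} → Free s e → inF s (low e) e ≡ true
  free⇒inF-low s {e} e-free =
    free⇒inF s e-free (low-endpoint e) (proj₁ (low-minimal e)) (proj₂ (low-minimal e))

  set-≡ : ∀ s e o → set s e o e ≡ o
  set-≡ s e o rewrite =ᶠ-refl e = refl

  set-≢ : ∀ s e o {f} → f ≢ e → set s e o f ≡ s f
  set-≢ s e o f≢e rewrite ≢⇒=ᶠfalse f≢e = refl

  Case : State → Fin n → Set
  Case s r = CaseI s r ⊎ CaseII s r

  -- makerAbove s r is definitionally count (above s r).
  above : State → Fin n → Fin m → Bool
  above s r f = isMaker (s f) ∧ not (horizontal f) ∧ inC s r (low f)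

  above-intro : ∀ {s r f} → isMaker (s f) ≡ true → not (horizontal f) ≡ true → inC s r (low f) ≡ true →
    above s r f ≡ true
  above-intro mk vert in-C = ∧-true mk (∧-true vert in-C)

  above-elim : ∀ {s r f} → above s r f ≡ true →
    isMaker (s f) ≡ true × not (horizontal f) ≡ true × inC s r (low f) ≡ true
  above-elim {s} {f = f} h =
    ∧-trueˡ h , ∧-trueˡ (∧-trueʳ {isMaker (s f)} h) , ∧-trueʳ {not (horizontal f)} (∧-trueʳ {isMaker (s f)} h)

  inF-intro : ∀ {s r f} → isFree (s f) ≡ true → alive b (ρ r) f ≡ true →
    (inC s r (src f) ∨ inC s r (tgt f)) ≡ true → inF s r f ≡ true
  inF-intro is-free is-alive inc = ∧-true is-free (∧-true is-alive inc)

  inF-elim : ∀ {s r f} → inF s r f ≡ true →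
    isFree (s f) ≡ true × alive b (ρ r) f ≡ true × (inC s r (src f) ∨ inC s r (tgt f)) ≡ true
  inF-elim {s} {r} {f} h =
    ∧-trueˡ h , ∧-trueˡ (∧-trueʳ {isFree (s f)} h) , ∧-trueʳ {alive b (ρ r) f} (∧-trueʳ {isFree (s f)} h)

  inF-cong : ∀ {s s' r f} → isFree (s' f) ≡ isFree (s f) → inC s' r ≗ inC s r → inF s' r f ≡ inF s r f
  inF-cong {r = r} {f} free≡ same =
    cong₂ (λ a c → a ∧ alive b (ρ r) f ∧ c) free≡ (cong₂ _∨_ (same (src f)) (same (tgt f)))

  inF-⊆ : ∀ {s s' r r'} → (isFree ∘ s') ⊆ᵇ (isFree ∘ s) → ρ r' ≡ ρ r → inC s' r' ≗ inC s r →
    inF s' r' ⊆ᵇ inF s r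
  inF-⊆ {s} {s'} {r} {r'} free⊆ ρ≡ same f h =
    ∧-true (free⊆ f (∧-trueˡ h)) (trans (sym incident≡) (∧-trueʳ {isFree (s' f)} h))
    where
    incident≡ : (alive b (ρ r') f ∧ (inC s' r' (src f) ∨ inC s' r' (tgt f)))
              ≡ (alive b (ρ r) f ∧ (inC s r (src f) ∨ inC s r (tgt f)))
    incident≡ = cong₂ (λ t c → alive b t f ∧ c) ρ≡ (cong₂ _∨_ (same (src f)) (same (tgt f)))

  Case-transport : ∀ {s s' r r'} → inC s' r' ≗ inC s r → makerAbove s' r' ≡ makerAbove s r →
    inF s' r' ⊆ᵇ inF s r → Case s r → Case s' r'
  Case-transport same above≡ F⊆ (inj₁ (one , empty)) =
    inj₁ (trans above≡ one , λ f → ¬-not λ h → false⇒¬true (empty f) (F⊆ f h))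
  Case-transport {s} {r = r} same above≡ F⊆ (inj₂ (none , bound)) =
    inj₂ (trans above≡ none , ≤-trans (count-mono F⊆)
      (subst (λ size → count (inF s r) ≤ suc (suc b) ∸ size) (sym (count-cong same)) bound))

  inF⇒CaseII : ∀ {s r e} → inF s r e ≡ true → Case s r → CaseII s r
  inF⇒CaseII e∈F (inj₁ (_ , empty)) = contradiction e∈F (false⇒¬true (empty _))
  inF⇒CaseII e∈F (inj₂ ii) = ii

  -- Breaker's moves

  -- s ≼ s' : s' arises from s by Breaker claims.
  _≼_ : State → State → Set
  s ≼ s' = (∀ f → isMaker (s' f) ≡ isMaker (s f)) × ((isFree ∘ s') ⊆ᵇ (isFree ∘ s))

  ≼-refl : ∀ {s} → s ≼ s
  ≼-refl = (λ _ → refl) , (λ _ h → h)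

  ≼-trans : ∀ {s₁ s₂ s₃} → s₁ ≼ s₂ → s₂ ≼ s₃ → s₁ ≼ s₃
  ≼-trans (maker₁₂ , free₁₂) (maker₂₃ , free₂₃) =
    (λ f → trans (maker₂₃ f) (maker₁₂ f)) , (λ f → free₁₂ f ∘ free₂₃ f)

  ≼-breaker-claim : ∀ {s e} → Free s e → s ≼ set s e breaker
  ≼-breaker-claim {s} {e} e-free = maker≡ , free⊆
    where
    maker≡ : ∀ f → isMaker (set s e breaker f) ≡ isMaker (s f)
    maker≡ f with f ≟ e
    ... | yes refl = sym (cong isMaker (isFree⇒free e-free))
    ... | no _ = refl
    free⊆ : (isFree ∘ set s e breaker) ⊆ᵇ (isFree ∘ s)
    free⊆ f h with f ≟ e
    ... | yes refl = contradiction h λ ()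
    ... | no _ = h

  BSteps⇒≼ : ∀ {u k s s'} → BSteps u k s s' → s ≼ s'
  BSteps⇒≼ done = ≼-refl
  BSteps⇒≼ (claim e (e-free , _) rest) = ≼-trans (≼-breaker-claim e-free) (BSteps⇒≼ rest)
  BSteps⇒≼ (stuck _) = ≼-refl

  ≼⇒inC≗ : ∀ {s s'} → s ≼ s' → ∀ r → inC s' r ≗ inC s r
  ≼⇒inC≗ (maker≡ , _) = inC-cong λ f → cong (_∧ horizontal f) (maker≡ f)

  ≼⇒makerAbove≡ : ∀ {s s'} → s ≼ s' → ∀ r → makerAbove s' r ≡ makerAbove s r
  ≼⇒makerAbove≡ ext@(maker≡ , _) r =
    count-cong λ f → cong₂ (λ a c → a ∧ not (horizontal f) ∧ c) (maker≡ f) (≼⇒inC≗ ext r (low f))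

  ≼⇒inF⊆ : ∀ {s s'} → s ≼ s' → ∀ r → inF s' r ⊆ᵇ inF s r
  ≼⇒inF⊆ ext r = inF-⊆ (proj₂ ext) refl (≼⇒inC≗ ext r)

  ≼-preserves-Case : ∀ {s s'} → s ≼ s' → ∀ r → Case s r → Case s' r
  ≼-preserves-Case ext r = Case-transport (≼⇒inC≗ ext r) (≼⇒makerAbove≡ ext r) (≼⇒inF⊆ ext r)

  allowed⇒inF-or-empty : ∀ {s u e} → Allowed s u e → inF s u e ≡ true ⊎ (∀ f → inF s u f ≡ false)
  allowed⇒inF-or-empty (_ , inj₁ e∈FV) = inj₁ (∧-trueˡ e∈FV)
  allowed⇒inF-or-empty (_ , inj₂ (inj₁ (_ , e∈FH))) = inj₁ (∧-trueˡ e∈FH)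
  allowed⇒inF-or-empty {s} {u} (_ , inj₂ (inj₂ (noFV , noFH))) = inj₂ λ f → ¬-not (empty f)
    where
    empty : ∀ f → ¬ inF s u f ≡ true
    empty f f∈F with horizontal f in hor
    ... | true  = noFH (f , ∧-true f∈F hor)
    ... | false = noFV (f , ∧-true f∈F (cong not hor))

  breaker-claim-shrinks-F : ∀ {s u e} → Free s e → inF s u e ≡ true →
    count (inF s u) ≡ suc (count (inF (set s e breaker) u))
  breaker-claim-shrinks-F {s} {u} {e} e-free e∈F =
    count-insert {p = inF s u} {q = inF (set s e breaker) u} off e∈F claimed
    where
    same : inC (set s e breaker) u ≗ inC s u
    same = ≼⇒inC≗ (≼-breaker-claim e-free) u
    off : ∀ f → f ≢ e → inF s u f ≡ inF (set s e breaker) u f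
    off f f≢e = sym (inF-cong (cong isFree (set-≢ s e breaker f≢e)) same)
    claimed : inF (set s e breaker) u e ≡ false
    claimed = ∧-falseˡ (cong isFree (set-≡ s e breaker))

  BSteps-shrink-F : ∀ {u k s s'} → BSteps u k s s' → count (inF s' u) ≤ count (inF s u) ∸ k
  BSteps-shrink-F done = ≤-refl
  BSteps-shrink-F {u} {suc k} {s} (stuck nothing-free) =
    subst (λ c → c ≤ c ∸ suc k) (sym (count-none {p = inF s u} λ f → ¬-not (nothing-free f ∘ ∧-trueˡ))) z≤n
  BSteps-shrink-F {u} {suc k} {s} {s'} steps@(claim e allowed@(e-free , _) rest)
    with allowed⇒inF-or-empty {s} {u} {e} allowed
  ... | inj₁ e∈F = subst (λ c → count (inF s' u) ≤ c ∸ suc k)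
                     (sym (breaker-claim-shrinks-F {s} {u} e-free e∈F)) (BSteps-shrink-F rest)
  ... | inj₂ empty = ≤-trans (count-mono (≼⇒inF⊆ (BSteps⇒≼ steps) u))
                       (subst (λ c → c ≤ c ∸ suc k) (sym (count-none {p = inF s u} empty)) z≤n)

  Case-same-comp : ∀ s {r u} → inC s r u ≡ true → Case s u → Case s r
  Case-same-comp s {r} {u} r∼u = Case-transport same (count-cong above≡) (inF-⊆ (λ _ h → h) ρ≡ same)
    where
    same : inC s r ≗ inC s u
    same = inC-same s r∼u
    above≡ : above s r ≗ above s u
    above≡ f = cong (λ c → isMaker (s f) ∧ not (horizontal f) ∧ c) (same (low f))
    ρ≡ : ρ r ≡ ρ u
    ρ≡ = sym (inC-ρ s r∼u)

  -- Maker's moves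

  module MakerClaim (s : State) (e : Fin m) (e-free : Free s e) where

    s₁ : State
    s₁ = set s e maker

    private
      a c : Fin n
      a = src e
      c = tgt e

    e-unclaimed : isMaker (s e) ≡ false
    e-unclaimed = cong isMaker (isFree⇒free e-free)

    mh-⊆ : mh s ⊆ᵇ mh s₁
    mh-⊆ f h with f ≟ e
    ... | yes refl = contradiction (∧-trueˡ h) (false⇒¬true e-unclaimed)
    ... | no _ = h

    mh-new : ∀ f → mh s₁ f ≡ true → mh s f ≡ true ⊎ f ≡ e
    mh-new f h with f ≟ e
    ... | yes f≡e = inj₂ f≡e
    ... | no _ = inj₁ h

    free-⊆ : (isFree ∘ s₁) ⊆ᵇ (isFree ∘ s)
    free-⊆ f h with f ≟ e
    ... | yes refl = contradiction h λ ()
    ... | no _ = h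

    comp-unchanged : ∀ r → (mh s₁ e ≡ true → inC s r (src e) ≡ inC s r (tgt e)) → inC s₁ r ≗ inC s r
    comp-unchanged r e-inside x = true-⇔⇒≡ (inC-least closed (inC-refl s r) x) (inC-mono mh-⊆ r x)
      where
      closed : Closed s₁ (inC s r)
      closed f mf with mh-new f mf
      ... | inj₁ mf₀ = inC-closed s r f mf₀
      ... | inj₂ refl = e-inside mf

    comp-unchanged-away : ∀ r → inC s₁ r (low e) ≡ false → inC s₁ r ≗ inC s r
    comp-unchanged-away r low∉ = comp-unchanged r λ me → trans (src∉ me) (sym (tgt∉ me))
      where
      src∉₁ : mh s₁ e ≡ true → inC s₁ r (src e) ≡ false
      src∉₁ me = subst (λ z → inC s₁ r z ≡ false) (horizontal⇒low≡src (∧-trueʳ me)) low∉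
      src∉ : mh s₁ e ≡ true → inC s r (src e) ≡ false
      src∉ me = ¬-not (false⇒¬true (src∉₁ me) ∘ inC-mono mh-⊆ r (src e))
      tgt∉ : mh s₁ e ≡ true → inC s r (tgt e) ≡ false
      tgt∉ me = ¬-not λ h → false⇒¬true (src∉₁ me) (trans (inC-closed s₁ r e me) (inC-mono mh-⊆ r (tgt e) h))

    above-off : ∀ {r} → inC s₁ r ≗ inC s r → ∀ f → f ≢ e → above s₁ r f ≡ above s r f
    above-off same f f≢e =
      cong₂ (λ a c → a ∧ not (horizontal f) ∧ c) (cong isMaker (set-≢ s e maker f≢e)) (same (low f))

    makerAbove-unchanged : ∀ {r} → inC s₁ r ≗ inC s r → horizontal e ≡ true ⊎ inC s₁ r (low e) ≡ false →
      makerAbove s₁ r ≡ makerAbove s r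
    makerAbove-unchanged same e-not-above =
      count-cong-except (above-off same) (trans (not-above e-not-above) (sym (∧-falseˡ e-unclaimed)))
      where
      not-above : ∀ {r} → horizontal e ≡ true ⊎ inC s₁ r (low e) ≡ false → above s₁ r e ≡ false
      not-above {r} (inj₁ hor) =
        trans (cong (λ c → isMaker (s₁ e) ∧ not c ∧ inC s₁ r (low e)) hor) (∧-zeroʳ _)
      not-above (inj₂ low∉) =
        trans (cong (λ c → isMaker (s₁ e) ∧ not (horizontal e) ∧ c) low∉)
              (trans (cong (isMaker (s₁ e) ∧_) (∧-zeroʳ _)) (∧-zeroʳ _))

    claim-preserves-Case : ∀ r → inC s₁ r ≗ inC s r → horizontal e ≡ true ⊎ inC s₁ r (low e) ≡ false →
      Case s r → Case s₁ r
    claim-preserves-Case r same e-not-above =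
      Case-transport same (makerAbove-unchanged same e-not-above) (inF-⊆ free-⊆ refl same)

    claim-removes-e : ∀ {r} → inC s₁ r ≗ inC s r → inF s r e ≡ true → count (inF s r) ≡ suc (count (inF s₁ r))
    claim-removes-e {r} same e∈F =
      count-insert {p = inF s r} {q = inF s₁ r} off e∈F (∧-falseˡ (cong isFree (set-≡ s e maker)))
      where
      off : ∀ f → f ≢ e → inF s r f ≡ inF s₁ r f
      off f f≢e = sym (inF-cong (cong isFree (set-≢ s e maker f≢e)) same)

    vertical-claim : horizontal e ≡ false → Case s (low e) →
      makerAbove s₁ (low e) ≡ 1 × count (inF s₁ (low e)) ≤ b
    vertical-claim vertical case = above≡1 , F≤b
      where
      u = low e
      same : inC s₁ u ≗ inC s u
      same = comp-unchanged u λ me → contradiction (∧-trueʳ me) (false⇒¬true vertical)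
      e∈F : inF s u e ≡ true
      e∈F = free⇒inF-low s e-free
      ii : CaseII s u
      ii = inF⇒CaseII e∈F case
      above≡1 : makerAbove s₁ u ≡ 1
      above≡1 = trans (count-insert {p = above s₁ u} {q = above s u} (above-off same)
                         (∧-true (cong isMaker (set-≡ s e maker)) (∧-true (cong not vertical) (inC-refl s₁ u)))
                         (∧-falseˡ e-unclaimed))
                      (cong suc (proj₁ ii))
      F≤b : count (inF s₁ u) ≤ b
      F≤b = ≤-pred (begin
        suc (count (inF s₁ u))   ≡⟨ sym (claim-removes-e same e∈F) ⟩
        count (inF s u)          ≤⟨ proj₂ ii ⟩
        suc (suc b) ∸ sizeC s u  ≤⟨ ∸-monoʳ-≤ (suc (suc b)) (witness⇒count≥1 {p = inC s u} (inC-refl s u)) ⟩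
        suc b                    ∎)
        where open ≤-Reasoning

    module _ (hor : horizontal e ≡ true) where

      e∈F-src : inF s a e ≡ true
      e∈F-src = free⇒inF s e-free (inj₁ refl) ≤-refl (≤-reflexive (horizontal⇒ρ≡ hor))

      e∈F-tgt : inF s c e ≡ true
      e∈F-tgt = free⇒inF s e-free (inj₂ refl) (≤-reflexive (sym (horizontal⇒ρ≡ hor))) ≤-refl

      claim-joins : inC s₁ a ≗ (λ x → inC s a x ∨ inC s c x)
      claim-joins x = true-⇔⇒≡ (inC-least closed (∨-trueˡ (inC-refl s a)) x) joined
        where
        closed : Closed s₁ (λ x → inC s a x ∨ inC s c x)
        closed f mf with mh-new f mf
        ... | inj₁ mf₀ = cong₂ _∨_ (inC-closed s a f mf₀) (inC-closed s c f mf₀)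
        ... | inj₂ refl = trans (∨-trueˡ (inC-refl s a)) (sym (∨-trueʳ (inC-refl s c)))
        c∈C₁a : inC s₁ a c ≡ true
        c∈C₁a = trans (sym (inC-closed s₁ a e (∧-true (cong isMaker (set-≡ s e maker)) hor))) (inC-refl s₁ a)
        joined : (inC s a x ∨ inC s c x) ≡ true → inC s₁ a x ≡ true
        joined h with ∨-true⁻ {inC s a x} h
        ... | inj₁ x∈Ca = inC-mono mh-⊆ a x x∈Ca
        ... | inj₂ x∈Cc = inC-trans s₁ c∈C₁a x (inC-mono mh-⊆ c x x∈Cc)

      inside-claim : inC s a c ≡ true → Case s a → Case s₁ a
      inside-claim c∈Ca = claim-preserves-Case a same (inj₁ hor)
        where
        same : inC s₁ a ≗ inC s a
        same = comp-unchanged a λ _ → trans (inC-refl s a) (sym c∈Ca)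

      module _ (c∉Ca : inC s a c ≡ false) where

        size-merged : sizeC s₁ a ≡ sizeC s a + sizeC s c
        size-merged = begin
          count (inC s₁ a)            ≡⟨ count-cong claim-joins ⟩
          count union                 ≡⟨ sym (+-identityʳ _) ⟩
          count union + 0             ≡⟨ cong (count union +_) (sym (count-none {p = meet} disjoint)) ⟩
          count union + count meet    ≡⟨ count-∨+count-∧ (inC s a) (inC s c) ⟩
          sizeC s a + sizeC s c       ∎
          where
          open ≡-Reasoning
          union meet : Fin n → Bool
          union x = inC s a x ∨ inC s c x
          meet x = inC s a x ∧ inC s c x
          disjoint : ∀ x → meet x ≡ false
          disjoint x = ¬-not λ h →
            false⇒¬true c∉Ca (inC-trans s (∧-trueˡ h) c (inC-sym s (∧-trueʳ {inC s a x} h)))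

        makerAbove-merged : CaseII s a → CaseII s c → makerAbove s₁ a ≡ 0
        makerAbove-merged (none-a , _) (none-c , _) = n≤0⇒n≡0 (begin
          count (above s₁ a)                                ≤⟨ count-mono from-sides ⟩
          count (λ f → above s a f ∨ above s c f)            ≤⟨ count-∨≤+ (above s a) (above s c) ⟩
          makerAbove s a + makerAbove s c                   ≡⟨ cong₂ _+_ none-a none-c ⟩
          0                                                 ∎)
          where
          open ≤-Reasoning
          from-sides : above s₁ a ⊆ᵇ (λ f → above s a f ∨ above s c f)
          from-sides f h with f ≟ e | above-elim {s₁} {a} {f} h
          ... | yes refl | _ , vert , _ = contradiction vert (false⇒¬true (cong not hor))
          ... | no _ | mk , vert , in₁ with ∨-true⁻ {inC s a (low f)} (trans (sym (claim-joins (low f))) in₁)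
          ...   | inj₁ in-a = ∨-trueˡ (above-intro {s} {a} mk vert in-a)
          ...   | inj₂ in-c = ∨-trueʳ (above-intro {s} {c} mk vert in-c)

        -- e is counted in both F(C_a) and F(C_c), and is no longer free.
        F-merged : suc (suc (count (inF s₁ a))) ≤ count (inF s a) + count (inF s c)
        F-merged = begin
          suc (suc (count (inF s₁ a)))         ≤⟨ s≤s (s≤s (count-mono from-sides)) ⟩
          suc (suc (count (either without e))) ≡⟨ cong suc (count-remove {p = either} (∨-trueˡ e∈F-src)) ⟩
          suc (count either)                   ≡⟨ +-comm 1 (count either) ⟩
          count either + 1                     ≤⟨ +-monoʳ-≤ (count either) (witness⇒count≥1 {p = both} e∈both) ⟩
          count either + count both            ≡⟨ count-∨+count-∧ (inF s a) (inF s c) ⟩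
          count (inF s a) + count (inF s c)    ∎
          where
          open ≤-Reasoning
          either both : Fin m → Bool
          either f = inF s a f ∨ inF s c f
          both f = inF s a f ∧ inF s c f
          e∈both : both e ≡ true
          e∈both = ∧-true e∈F-src e∈F-tgt
          from-sides : inF s₁ a ⊆ᵇ (either without e)
          from-sides f h with f ≟ e | inF-elim {s₁} {a} {f} h
          ... | yes refl | () , _
          ... | no _ | is-free , is-alive , inc = ∧-true (incident-side inc) refl
            where
            in-F : ∀ {r} → ρ r ≡ ρ a → (inC s r (src f) ∨ inC s r (tgt f)) ≡ true → inF s r f ≡ true
            in-F ρ≡ = inF-intro is-free (subst (λ t → alive b t f ≡ true) (sym ρ≡) is-alive)
            side : ∀ x → inC s₁ a x ≡ true → inC s a x ≡ true ⊎ inC s c x ≡ true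
            side x x∈C₁ = ∨-true⁻ (trans (sym (claim-joins x)) x∈C₁)
            incident-side : (inC s₁ a (src f) ∨ inC s₁ a (tgt f)) ≡ true → either f ≡ true
            incident-side inc with ∨-true⁻ inc
            ... | inj₁ src∈ with side (src f) src∈
            ...   | inj₁ in-a = ∨-trueˡ (in-F refl (∨-trueˡ in-a))
            ...   | inj₂ in-c = ∨-trueʳ (in-F (sym (horizontal⇒ρ≡ hor)) (∨-trueˡ in-c))
            incident-side inc | inj₂ tgt∈ with side (tgt f) tgt∈
            ...   | inj₁ in-a = ∨-trueˡ (in-F refl (∨-trueʳ in-a))
            ...   | inj₂ in-c = ∨-trueʳ (in-F (sym (horizontal⇒ρ≡ hor)) (∨-trueʳ in-c))

    module _ {s₂ : State} (inv : ∀ r → Case s r) where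

      vertical-round : horizontal e ≡ false → BSteps (low e) b s₁ s₂ → CaseI s₂ (low e)
      vertical-round vertical steps with vertical-claim vertical (inv (low e))
      ... | above≡1 , F≤b =
        trans (≼⇒makerAbove≡ (BSteps⇒≼ steps) (low e)) above≡1 ,
        count≡0⇒none (n≤0⇒n≡0 (≤-trans (BSteps-shrink-F steps) (≤-reflexive (m≤n⇒m∸n≡0 F≤b))))

      merge-round : (hor : horizontal e ≡ true) → inC s a c ≡ false → BSteps a b s₁ s₂ → CaseII s₂ a
      merge-round hor c∉Ca steps =
        trans (≼⇒makerAbove≡ ext a) (makerAbove-merged hor c∉Ca ii-a ii-c) , F-bound
        where
        ext : s₁ ≼ s₂
        ext = BSteps⇒≼ steps
        ii-a : CaseII s a
        ii-a = inF⇒CaseII (e∈F-src hor) (inv a)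
        ii-c : CaseII s c
        ii-c = inF⇒CaseII (e∈F-tgt hor) (inv c)
        size≡ : sizeC s₂ a ≡ sizeC s a + sizeC s c
        size≡ = trans (count-cong (≼⇒inC≗ ext a)) (size-merged hor c∉Ca)
        F-bound : count (inF s₂ a) ≤ suc (suc b) ∸ sizeC s₂ a
        F-bound = begin
          count (inF s₂ a)                       ≤⟨ BSteps-shrink-F steps ⟩
          count (inF s₁ a) ∸ b
            ≤⟨ merged-bound b {s = sizeC s a} {sizeC s c}
                 (witness⇒count≥1 {p = inF s a} (e∈F-src hor)) (proj₂ ii-a)
                 (witness⇒count≥1 {p = inF s c} (e∈F-tgt hor)) (proj₂ ii-c)
                 (F-merged hor c∉Ca) ⟩
          suc (suc b) ∸ (sizeC s a + sizeC s c)  ≡⟨ cong (suc (suc b) ∸_) (sym size≡) ⟩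
          suc (suc b) ∸ sizeC s₂ a               ∎
          where open ≤-Reasoning

      horizontal-round : horizontal e ≡ true → BSteps a b s₁ s₂ → Case s₂ a
      horizontal-round hor steps with inC s a c in c∈?
      ... | true  = ≼-preserves-Case (BSteps⇒≼ steps) a (inside-claim hor c∈? (inv a))
      ... | false = inj₂ (merge-round hor c∈? steps)

      round-at-low : BSteps (low e) b s₁ s₂ → Case s₂ (low e)
      round-at-low steps with horizontal e in hor
      ... | false = inj₁ (vertical-round hor steps)
      ... | true  = subst (Case s₂) (sym low≡src)
                      (horizontal-round hor (subst (λ u → BSteps u b s₁ s₂) low≡src steps))
        where
        low≡src : low e ≡ a
        low≡src = horizontal⇒low≡src hor

      round : BSteps (low e) b s₁ s₂ → ∀ r → Case s₂ r
      round steps r with inC s₁ r (low e) in low∈?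
      ... | false = ≼-preserves-Case (BSteps⇒≼ steps) r
                      (claim-preserves-Case r (comp-unchanged-away r low∈?) (inj₂ low∈?) (inv r))
      ... | true  = Case-same-comp s₂ (trans (≼⇒inC≗ (BSteps⇒≼ steps) r (low e)) low∈?) (round-at-low steps)

  start-Case : ∀ r → Case start r
  start-Case r = inj₂ (count-none {p = above start r} (λ _ → refl) , F-bound)
    where
    singleton : inC start r ≗ (_=ᶠ r)
    singleton x = true-⇔⇒≡ (inC-least (λ _ ()) (=ᶠ-refl r) x)
                            (λ h → subst (λ z → inC start r z ≡ true) (sym (=ᶠ⇒≡ h)) (inC-refl start r))
    F⊆incident : inF start r ⊆ᵇ (λ f → alive b (ρ r) f ∧ incident f r)
    F⊆incident f h with inF-elim {start} {r} {f} h
    ... | _ , is-alive , inc =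
      ∧-true is-alive (trans (sym (cong₂ _∨_ (singleton (src f)) (singleton (tgt f)))) inc)
    F-bound : count (inF start r) ≤ suc (suc b) ∸ sizeC start r
    F-bound rewrite count-cong singleton | count-singleton r =
      ≤-trans (count-mono F⊆incident) (≤-pred (proj₁ (ρ-rank r)))

  Reachable⇒Case : ∀ {s} → Reachable s → ∀ r → Case s r
  Reachable⇒Case init = start-Case
  Reachable⇒Case (step reachable (e , e-free , steps)) =
    MakerClaim.round _ e e-free (Reachable⇒Case reachable) steps

  CaseI-CaseII-exclusive : ∀ {s r} → ¬ (CaseI s r × CaseII s r)
  CaseI-CaseII-exclusive ((one , _) , (none , _)) = 1+n≢0 (trans (sym one) none)

-- Degeneracy only serves to make every rank finite, which the rank hypothesis already
-- provides.
claim8 : (b : ℕ) → 1 ≤ b → {n m : ℕ} (G : Graph n m) →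
    GraphDefs.Degenerate G b →
    (ρ : Fin n → ℕ) → (∀ v → GraphDefs.IsRank G b v (ρ v)) →
    ∀ s → Game.Reachable G b ρ s → ∀ (r : Fin n) →
    (Game.CaseI G b ρ s r ⊎ Game.CaseII G b ρ s r)
    × ¬ (Game.CaseI G b ρ s r × Game.CaseII G b ρ s r)
claim8 b _ G _ ρ ρ-rank s reachable r = Reachable⇒Case reachable r , CaseI-CaseII-exclusive
  where open Analysis G b ρ ρ-rank
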